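{- Let $\tau$ be an ordinal and $\alpha,\beta$ ordinals with $\max(\alpha,\beta)+2<\tau$. Then $\mathrm{CTT}^\tau$ proves $a^\alpha\,\hat\in\,b^{\beta+1}\leftrightarrow\exists x^\beta(x^\beta\equiv a^\alpha\wedge b^{\beta+1}(x^\beta))$.
   Context: Cumulative type theory $\mathrm{CTT}^{\tau}$ ($\tau$ an ordinal). The type indices are the ordinals $\alpha<\tau$; for each $\alpha<\tau$ there are countably many variables of type $\alpha$. Atomic formulas: $b^\beta(a^\alpha)$, well-formed iff $\alpha<\beta<\tau$; and $a^\alpha=b^\alpha$ (same type only). Logic: classical natural deduction with usual identity rules at each type and quantifier rules: for all $\alpha\le\beta<\tau$, from $\forall x^\beta\phi(x^\beta)$ infer $\phi(a^\alpha)$; from $\phi(b^\beta)$ infer $\forall x^\alpha\phi(x^\alpha)$, provided all expressions are well-formed and $b^\beta$ does not occur in undischarged assumptions on which $\phi(b^\beta)$ depends (dually for $\exists$). Comprehension: $\exists z^{\alpha+1}\forall x^\alpha(z^{\alpha+1}(x^\alpha)\leftrightarrow\phi(x^\alpha))$ for $\alpha+1<\tau$ and well-formed $\phi$ not containing $z^{\alpha+1}$. Limit rule for limit $\lambda<\tau$: from $\forall x^\alpha\phi(x^\alpha)$ for all $\alpha<\lambda$ infer $\forall x^\lambda\phi(x^\lambda)$. Defined: with $\gamma=\max(\alpha,\beta)+1$, $a^\alpha\equiv b^\beta:\Leftrightarrow\forall x^\gamma(x^\gamma(a^\alpha)\leftrightarrow x^\gamma(b^\beta))$ and $a^\alpha\,\hat\in\,b^\beta:\Leftrightarrow\exists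 x^\gamma(x^\gamma\equiv b^\beta\wedge x^\gamma(a^\alpha))$. Further axioms (whenever well-formed): Type-Founded $\forall a^\alpha\forall b^{\beta+1}(a^\alpha\,\hat\in\,b^{\beta+1}\to\exists x^\beta\,a^\alpha\equiv x^\beta)$; Type-Base $\forall x^0\forall y^\alpha\neg(y^\alpha\,\hat\in\,x^0)$. -}

module Defs where

open import Data.Nat using (ℕ)
open import Data.List using (List; []; _∷_)
open import Data.List.Membership.Propositional using (_∈_)
open import Data.List.Relation.Unary.All using (All)
open import Data.Product using (Σ; _×_; _,_)
open import Data.Sum using (_⊎_)
open import Relation.Nullary using (¬_)
open import Relation.Binary.PropositionalEquality using (_≡_; _≢_)
open import Relation.Binary.Structures using (IsStrictTotalOrder)
open import Induction.WellFounded using (WellFounded)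

-- An ordinal τ, represented (as usual) by the well-ordered set of its
-- predecessors: Carrier = { α | α < τ }, the set of type indices of CTT^τ.

record Ordinal : Set₁ where
  field
    Carrier            : Set
    _<_                : Carrier → Carrier → Set
    isStrictTotalOrder : IsStrictTotalOrder _≡_ _<_
    wellFounded        : WellFounded _<_

module CTT (τ : Ordinal) where
  open Ordinal τ public

  infix 4 _≤_
  _≤_ : Carrier → Carrier → Set
  α ≤ β = α < β ⊎ α ≡ β

  IsSucc : Carrier → Carrier → Set
  IsSucc α s = α < s × (∀ γ → α < γ → s ≤ γ)

  IsZero : Carrier → Set
  IsZero α = ∀ γ → ¬ (γ < α)

  IsLimit : Carrier → Set
  IsLimit l = ¬ IsZero l × (∀ γ → ¬ IsSucc γ l)

  IsMax : Carrier → Carrier → Carrier → Set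
  IsMax α β m = α ≤ m × β ≤ m × (m ≡ α ⊎ m ≡ β)

  SuccMax : Carrier → Carrier → Carrier → Set
  SuccMax α β γ = Σ Carrier (λ m → IsMax α β m × IsSucc m γ)

  record Var : Set where
    constructor var
    field
      ty : Carrier
      nm : ℕ
  open Var public

  infixr 6 _∧ᶠ_
  infixr 5 _∨ᶠ_
  infixr 4 _⇒_ _⇔ᶠ_
  data Fm : Set where
    app  : Var → Var → Fm          -- app b a  is  b(a)
    _≐_  : Var → Var → Fm
    ⊥ᶠ   : Fm
    _⇒_  : Fm → Fm → Fm
    _∧ᶠ_ : Fm → Fm → Fm
    _∨ᶠ_ : Fm → Fm → Fm
    ∀ᶠ   : Var → Fm → Fm
    ∃ᶠ   : Var → Fm → Fm

  ¬ᶠ_ : Fm → Fm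
  ¬ᶠ φ = φ ⇒ ⊥ᶠ

  _⇔ᶠ_ : Fm → Fm → Fm
  φ ⇔ᶠ ψ = (φ ⇒ ψ) ∧ᶠ (ψ ⇒ φ)

  data WF : Fm → Set where
    wf-app : ∀ {b a} → ty a < ty b → WF (app b a)
    wf-eq  : ∀ {a b} → ty a ≡ ty b → WF (a ≐ b)
    wf-⊥   : WF ⊥ᶠ
    wf-⇒   : ∀ {φ ψ} → WF φ → WF ψ → WF (φ ⇒ ψ)
    wf-∧   : ∀ {φ ψ} → WF φ → WF ψ → WF (φ ∧ᶠ ψ)
    wf-∨   : ∀ {φ ψ} → WF φ → WF ψ → WF (φ ∨ᶠ ψ)
    wf-∀   : ∀ {x φ} → WF φ → WF (∀ᶠ x φ)
    wf-∃   : ∀ {x φ} → WF φ → WF (∃ᶠ x φ)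

  data FreeIn (v : Var) : Fm → Set where
    fr-app₁ : ∀ {a} → FreeIn v (app v a)
    fr-app₂ : ∀ {b} → FreeIn v (app b v)
    fr-eq₁  : ∀ {a} → FreeIn v (v ≐ a)
    fr-eq₂  : ∀ {a} → FreeIn v (a ≐ v)
    fr-⇒₁   : ∀ {φ ψ} → FreeIn v φ → FreeIn v (φ ⇒ ψ)
    fr-⇒₂   : ∀ {φ ψ} → FreeIn v ψ → FreeIn v (φ ⇒ ψ)
    fr-∧₁   : ∀ {φ ψ} → FreeIn v φ → FreeIn v (φ ∧ᶠ ψ)
    fr-∧₂   : ∀ {φ ψ} → FreeIn v ψ → FreeIn v (φ ∧ᶠ ψ)
    fr-∨₁   : ∀ {φ ψ} → FreeIn v φ → FreeIn v (φ ∨ᶠ ψ)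
    fr-∨₂   : ∀ {φ ψ} → FreeIn v ψ → FreeIn v (φ ∨ᶠ ψ)
    fr-∀    : ∀ {x φ} → x ≢ v → FreeIn v φ → FreeIn v (∀ᶠ x φ)
    fr-∃    : ∀ {x φ} → x ≢ v → FreeIn v φ → FreeIn v (∃ᶠ x φ)

  data Occurs (v : Var) : Fm → Set where
    oc-app₁ : ∀ {a} → Occurs v (app v a)
    oc-app₂ : ∀ {b} → Occurs v (app b v)
    oc-eq₁  : ∀ {a} → Occurs v (v ≐ a)
    oc-eq₂  : ∀ {a} → Occurs v (a ≐ v)
    oc-⇒₁   : ∀ {φ ψ} → Occurs v φ → Occurs v (φ ⇒ ψ)
    oc-⇒₂   : ∀ {φ ψ} → Occurs v ψ → Occurs v (φ ⇒ ψ)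
    oc-∧₁   : ∀ {φ ψ} → Occurs v φ → Occurs v (φ ∧ᶠ ψ)
    oc-∧₂   : ∀ {φ ψ} → Occurs v ψ → Occurs v (φ ∧ᶠ ψ)
    oc-∨₁   : ∀ {φ ψ} → Occurs v φ → Occurs v (φ ∨ᶠ ψ)
    oc-∨₂   : ∀ {φ ψ} → Occurs v ψ → Occurs v (φ ∨ᶠ ψ)
    oc-∀b   : ∀ {φ} → Occurs v (∀ᶠ v φ)
    oc-∀    : ∀ {x φ} → Occurs v φ → Occurs v (∀ᶠ x φ)
    oc-∃b   : ∀ {φ} → Occurs v (∃ᶠ v φ)
    oc-∃    : ∀ {x φ} → Occurs v φ → Occurs v (∃ᶠ x φ)

  data SubV (x t : Var) : Var → Var → Set where
    sv-hit  : SubV x t x t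
    sv-miss : ∀ {v} → v ≢ x → SubV x t v v

  -- Sub x t φ ψ : ψ is φ[x := t] (substitution of t for the free
  -- occurrences of x), and t is free for x in φ
  data Sub (x t : Var) : Fm → Fm → Set where
    s-app : ∀ {b a b' a'} → SubV x t b b' → SubV x t a a' → Sub x t (app b a) (app b' a')
    s-eq  : ∀ {a b a' b'} → SubV x t a a' → SubV x t b b' → Sub x t (a ≐ b) (a' ≐ b')
    s-⊥   : Sub x t ⊥ᶠ ⊥ᶠ
    s-⇒   : ∀ {φ ψ φ' ψ'} → Sub x t φ φ' → Sub x t ψ ψ' → Sub x t (φ ⇒ ψ) (φ' ⇒ ψ')
    s-∧   : ∀ {φ ψ φ' ψ'} → Sub x t φ φ' → Sub x t ψ ψ' → Sub x t (φ ∧ᶠ ψ) (φ' ∧ᶠ ψ')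
    s-∨   : ∀ {φ ψ φ' ψ'} → Sub x t φ φ' → Sub x t ψ ψ' → Sub x t (φ ∨ᶠ ψ) (φ' ∨ᶠ ψ')
    s-∀b  : ∀ {φ} → Sub x t (∀ᶠ x φ) (∀ᶠ x φ)
    s-∀nf : ∀ {y φ} → y ≢ x → ¬ FreeIn x φ → Sub x t (∀ᶠ y φ) (∀ᶠ y φ)
    s-∀   : ∀ {y φ φ'} → y ≢ x → y ≢ t → Sub x t φ φ' → Sub x t (∀ᶠ y φ) (∀ᶠ y φ')
    s-∃b  : ∀ {φ} → Sub x t (∃ᶠ x φ) (∃ᶠ x φ)
    s-∃nf : ∀ {y φ} → y ≢ x → ¬ FreeIn x φ → Sub x t (∃ᶠ y φ) (∃ᶠ y φ)
    s-∃   : ∀ {y φ φ'} → y ≢ x → y ≢ t → Sub x t φ φ' → Sub x t (∃ᶠ y φ) (∃ᶠ y φ')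

  -- a ≡ b  :=  ∀z (z(a) ↔ z(b)),  with the bound variable z supplied
  -- (its type must be max(ty a, ty b) + 1, imposed where used)
  Equiv : (z a b : Var) → Fm
  Equiv z a b = ∀ᶠ z (app z a ⇔ᶠ app z b)

  -- a ∈̂ b  :=  ∃x (x ≡ b ∧ x(a)),  bound variables x, z supplied
  -- (ty x = max(ty a, ty b) + 1, ty z = max(ty x, ty b) + 1)
  HatIn : (x z a b : Var) → Fm
  HatIn x z a b = ∃ᶠ x (Equiv z x b ∧ᶠ app x a)

  NotFreeIn : Var → Fm → Set
  NotFreeIn v φ = ¬ FreeIn v φ

  -- derivability in CTT^τ (classical natural deduction, sequent style;
  -- Γ is the list of undischarged assumptions)
  infix 2 _⊢_
  data _⊢_ (Γ : List Fm) : Fm → Set where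
    hyp   : ∀ {φ} → φ ∈ Γ → Γ ⊢ φ
    ⇒I    : ∀ {φ ψ} → WF φ → (φ ∷ Γ) ⊢ ψ → Γ ⊢ φ ⇒ ψ
    ⇒E    : ∀ {φ ψ} → Γ ⊢ φ ⇒ ψ → Γ ⊢ φ → Γ ⊢ ψ
    ∧I    : ∀ {φ ψ} → Γ ⊢ φ → Γ ⊢ ψ → Γ ⊢ φ ∧ᶠ ψ
    ∧E₁   : ∀ {φ ψ} → Γ ⊢ φ ∧ᶠ ψ → Γ ⊢ φ
    ∧E₂   : ∀ {φ ψ} → Γ ⊢ φ ∧ᶠ ψ → Γ ⊢ ψ
    ∨I₁   : ∀ {φ ψ} → WF ψ → Γ ⊢ φ → Γ ⊢ φ ∨ᶠ ψ
    ∨I₂   : ∀ {φ ψ} → WF φ → Γ ⊢ ψ → Γ ⊢ φ ∨ᶠ ψ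
    ∨E    : ∀ {φ ψ χ} → Γ ⊢ φ ∨ᶠ ψ → (φ ∷ Γ) ⊢ χ → (ψ ∷ Γ) ⊢ χ → Γ ⊢ χ
    ⊥E    : ∀ {φ} → WF φ → Γ ⊢ ⊥ᶠ → Γ ⊢ φ
    raa   : ∀ {φ} → WF φ → ((¬ᶠ φ) ∷ Γ) ⊢ ⊥ᶠ → Γ ⊢ φ
    ∀E    : ∀ {x a φ ψ} → ty a ≤ ty x → WF ψ → Sub x a φ ψ →
            Γ ⊢ ∀ᶠ x φ → Γ ⊢ ψ
    ∀I    : ∀ {x b φ ψ} → ty x ≤ ty b → WF (∀ᶠ x φ) → WF ψ → Sub x b φ ψ →
            NotFreeIn b (∀ᶠ x φ) → All (NotFreeIn b) Γ →
            Γ ⊢ ψ → Γ ⊢ ∀ᶠ x φ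
    ∃I    : ∀ {x a φ ψ} → ty a ≤ ty x → WF (∃ᶠ x φ) → WF ψ → Sub x a φ ψ →
            Γ ⊢ ψ → Γ ⊢ ∃ᶠ x φ
    ∃E    : ∀ {x b φ ψ χ} → ty x ≤ ty b → WF ψ → Sub x b φ ψ →
            NotFreeIn b (∃ᶠ x φ) → NotFreeIn b χ → All (NotFreeIn b) Γ →
            Γ ⊢ ∃ᶠ x φ → (ψ ∷ Γ) ⊢ χ → Γ ⊢ χ
    ≐refl : ∀ {a} → Γ ⊢ a ≐ a
    ≐E    : ∀ {x a b φ φa φb} → ty x ≡ ty a → Sub x a φ φa → Sub x b φ φb →
            WF φb → Γ ⊢ a ≐ b → Γ ⊢ φa → Γ ⊢ φb
    compr : ∀ {z x φ} → IsSucc (ty x) (ty z) → WF φ → ¬ Occurs z φ →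
            Γ ⊢ ∃ᶠ z (∀ᶠ x (app z x ⇔ᶠ φ))
    limit : ∀ {x φ} → IsLimit (ty x) → WF (∀ᶠ x φ) →
            (∀ α → α < ty x →
               Σ Var (λ y → ty y ≡ α × NotFreeIn y (∀ᶠ x φ) ×
                 Σ Fm (λ ψ → Sub x y φ ψ × (Γ ⊢ ∀ᶠ y ψ)))) →
            Γ ⊢ ∀ᶠ x φ
    typeFounded : ∀ {β} (a b x z y w : Var) →
            IsSucc β (ty b) → a ≢ b →
            SuccMax (ty a) (ty b) (ty x) → SuccMax (ty x) (ty b) (ty z) →
            ty y ≡ β → y ≢ a → SuccMax (ty a) (ty y) (ty w) →
            Γ ⊢ ∀ᶠ a (∀ᶠ b (HatIn x z a b ⇒ ∃ᶠ y (Equiv w a y)))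
    typeBase : ∀ (x y u v : Var) → IsZero (ty x) → x ≢ y →
            SuccMax (ty y) (ty x) (ty u) → SuccMax (ty u) (ty x) (ty v) →
            Γ ⊢ ∀ᶠ x (∀ᶠ y (¬ᶠ HatIn u v y x))

{-# OPTIONS --safe #-}
module Submission where

-- (⇒) Type-Founded gives a variable y of type β with a ≡ y.  Identity ≡ is symmetric and
-- obeys Leibniz's law: to move φ(p) along p ≡ q, apply p ≡ q to the comprehension class
-- {u | φ(u)}, whose type is exactly the level at which ≡ quantifies.  Moving a ∈̂ b along
-- a ≡ y gives y ∈̂ b, and y ∈̂ b yields b(y) by applying the witness's x ≡ b to {v | v(y)}.
-- (⇐) b(y) gives y ∈̂ b with witness b itself, which moves along y ≡ a to a ∈̂ b.

open import Defs
open import Data.List using (List; []; _∷_)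
open import Data.List.Membership.Propositional using (_∈_)
open import Data.List.Relation.Unary.All using (All; []; _∷_)
open import Data.List.Relation.Unary.Any using (here; there)
open import Data.Nat as ℕ using (ℕ; suc; _⊔_)
import Data.Nat.Properties as ℕₚ
open import Data.Product using (_,_; proj₁; proj₂)
open import Data.Sum using (inj₁; inj₂; swap)
open import Relation.Nullary using (¬_; Dec; yes; no)
open import Relation.Binary.PropositionalEquality using (_≡_; _≢_; refl; sym; ≢-sym)
open import Relation.Binary.Structures using (IsStrictTotalOrder)
import Relation.Binary.Construct.StrictToNonStrict as NonStrict

module Derivations (τ : Ordinal) where
  open CTT τ
  open IsStrictTotalOrder isStrictTotalOrder
    using (irrefl; <-respʳ-≈; <-respˡ-≈; _≟_) renaming (trans to <-trans)

  <-≤-trans : ∀ {α β γ} → α < β → β ≤ γ → α < γ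
  <-≤-trans = NonStrict.<-≤-trans _≡_ _<_ <-trans <-respʳ-≈

  ≤-<-trans : ∀ {α β γ} → α ≤ β → β < γ → α < γ
  ≤-<-trans = NonStrict.≤-<-trans _≡_ _<_ sym <-trans <-respˡ-≈

  isMax-lub : ∀ {α β m γ} → IsMax α β m → α < γ → β < γ → m < γ
  isMax-lub (_ , _ , inj₁ refl) α<γ _ = α<γ
  isMax-lub (_ , _ , inj₂ refl) _ β<γ = β<γ

  succMax-<ˡ : ∀ {α β γ} → SuccMax α β γ → α < γ
  succMax-<ˡ (_ , (α≤m , _) , m<γ , _) = ≤-<-trans α≤m m<γ

  succMax-<ʳ : ∀ {α β γ} → SuccMax α β γ → β < γ
  succMax-<ʳ (_ , (_ , β≤m , _) , m<γ , _) = ≤-<-trans β≤m m<γ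

  succMax-sym : ∀ {α β γ} → SuccMax α β γ → SuccMax β α γ
  succMax-sym (m , (α≤m , β≤m , m≡α∨β) , m⁺≡γ) = m , (β≤m , α≤m , swap m≡α∨β) , m⁺≡γ

  ty<⇒≢ : ∀ {p q} → ty p < ty q → p ≢ q
  ty<⇒≢ p<q refl = irrefl refl p<q

  ty>⇒≢ : ∀ {p q} → ty q < ty p → p ≢ q
  ty>⇒≢ q<p = ≢-sym (ty<⇒≢ q<p)

  _≟ᵛ_ : (p q : Var) → Dec (p ≡ q)
  var α m ≟ᵛ var β n with α ≟ β | m ℕ.≟ n
  ... | yes refl | yes refl = yes refl
  ... | no α≢β   | _        = no λ { refl → α≢β refl }
  ... | yes _    | no m≢n   = no λ { refl → m≢n refl }

  freshName : List Var → ℕ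
  freshName []       = 0
  freshName (v ∷ vs) = suc (nm v) ⊔ freshName vs

  nm<freshName : ∀ {v vs} → v ∈ vs → nm v ℕ.< freshName vs
  nm<freshName {vs = v ∷ vs} (here refl) = ℕₚ.m≤m⊔n (suc (nm v)) (freshName vs)
  nm<freshName {vs = u ∷ vs} (there v∈vs) =
    ℕₚ.<-≤-trans (nm<freshName v∈vs) (ℕₚ.m≤n⊔m (suc (nm u)) (freshName vs))

  fresh : List Var → Carrier → Var
  fresh vs α = var α (freshName vs)

  fresh-≢ : ∀ {v} vs {α} → v ∈ vs → fresh vs α ≢ v
  fresh-≢ _ v∈vs refl = ℕₚ.<-irrefl refl (nm<freshName v∈vs)

  subV-refl : ∀ x v → SubV x x v v
  subV-refl x v with v ≟ᵛ x
  ... | yes refl = sv-hit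
  ... | no v≢x   = sv-miss v≢x

  sub-refl : ∀ x φ → Sub x x φ φ
  sub-refl x (app p q) = s-app (subV-refl x p) (subV-refl x q)
  sub-refl x (p ≐ q)   = s-eq (subV-refl x p) (subV-refl x q)
  sub-refl x ⊥ᶠ        = s-⊥
  sub-refl x (φ ⇒ ψ)   = s-⇒ (sub-refl x φ) (sub-refl x ψ)
  sub-refl x (φ ∧ᶠ ψ)  = s-∧ (sub-refl x φ) (sub-refl x ψ)
  sub-refl x (φ ∨ᶠ ψ)  = s-∨ (sub-refl x φ) (sub-refl x ψ)
  sub-refl x (∀ᶠ y φ) with y ≟ᵛ x
  ... | yes refl = s-∀b
  ... | no y≢x   = s-∀ y≢x y≢x (sub-refl x φ)
  sub-refl x (∃ᶠ y φ) with y ≟ᵛ x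
  ... | yes refl = s-∃b
  ... | no y≢x   = s-∃ y≢x y≢x (sub-refl x φ)

  sub-⇔ : ∀ {s t φ ψ φ′ ψ′} → Sub s t φ φ′ → Sub s t ψ ψ′ → Sub s t (φ ⇔ᶠ ψ) (φ′ ⇔ᶠ ψ′)
  sub-⇔ sφ sψ = s-∧ (s-⇒ sφ sψ) (s-⇒ sψ sφ)

  sub-Equiv-body : ∀ {e t p q} → p ≢ e → q ≢ e →
                   Sub e t (app e p ⇔ᶠ app e q) (app t p ⇔ᶠ app t q)
  sub-Equiv-body p≢e q≢e = sub-⇔ (s-app sv-hit (sv-miss p≢e)) (s-app sv-hit (sv-miss q≢e))

  sub-Equiv : ∀ {s t e p q p′ q′} → e ≢ s → e ≢ t → SubV s t p p′ → SubV s t q q′ →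
              Sub s t (Equiv e p q) (Equiv e p′ q′)
  sub-Equiv e≢s e≢t sp sq = s-∀ e≢s e≢t (sub-⇔ (s-app (sv-miss e≢s) sp) (s-app (sv-miss e≢s) sq))

  sub-HatIn : ∀ {s t X Z p q p′ q′} → X ≢ s → X ≢ t → Z ≢ s → Z ≢ t →
              SubV s t p p′ → SubV s t q q′ → Sub s t (HatIn X Z p q) (HatIn X Z p′ q′)
  sub-HatIn X≢s X≢t Z≢s Z≢t sp sq =
    s-∃ X≢s X≢t (s-∧ (sub-Equiv Z≢s Z≢t (sv-miss X≢s) sq) (s-app (sv-miss X≢s) sp))

  wf-⇔ : ∀ {φ ψ} → WF φ → WF ψ → WF (φ ⇔ᶠ ψ)
  wf-⇔ wφ wψ = wf-∧ (wf-⇒ wφ wψ) (wf-⇒ wψ wφ)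

  wf-Equiv : ∀ {e p q} → ty p < ty e → ty q < ty e → WF (Equiv e p q)
  wf-Equiv p<e q<e = wf-∀ (wf-⇔ (wf-app p<e) (wf-app q<e))

  wf-HatIn : ∀ {X Z p q} → ty p < ty X → ty X < ty Z → ty q < ty Z → WF (HatIn X Z p q)
  wf-HatIn p<X X<Z q<Z = wf-∃ (wf-∧ (wf-Equiv X<Z q<Z) (wf-app p<X))

  notFree-app : ∀ {v p q} → v ≢ p → v ≢ q → NotFreeIn v (app p q)
  notFree-app v≢p v≢q fr-app₁ = v≢p refl
  notFree-app v≢p v≢q fr-app₂ = v≢q refl

  notFree-⇒ : ∀ {v φ ψ} → NotFreeIn v φ → NotFreeIn v ψ → NotFreeIn v (φ ⇒ ψ)
  notFree-⇒ v∉φ v∉ψ (fr-⇒₁ f) = v∉φ f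
  notFree-⇒ v∉φ v∉ψ (fr-⇒₂ f) = v∉ψ f

  notFree-∧ : ∀ {v φ ψ} → NotFreeIn v φ → NotFreeIn v ψ → NotFreeIn v (φ ∧ᶠ ψ)
  notFree-∧ v∉φ v∉ψ (fr-∧₁ f) = v∉φ f
  notFree-∧ v∉φ v∉ψ (fr-∧₂ f) = v∉ψ f

  notFree-⇔ : ∀ {v φ ψ} → NotFreeIn v φ → NotFreeIn v ψ → NotFreeIn v (φ ⇔ᶠ ψ)
  notFree-⇔ v∉φ v∉ψ = notFree-∧ (notFree-⇒ v∉φ v∉ψ) (notFree-⇒ v∉ψ v∉φ)

  notFree-∃ : ∀ {v y φ} → NotFreeIn v φ → NotFreeIn v (∃ᶠ y φ)
  notFree-∃ v∉φ (fr-∃ _ f) = v∉φ f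

  notFree-∀-bound : ∀ {v φ} → NotFreeIn v (∀ᶠ v φ)
  notFree-∀-bound (fr-∀ v≢v _) = v≢v refl

  notFree-∃-bound : ∀ {v φ} → NotFreeIn v (∃ᶠ v φ)
  notFree-∃-bound (fr-∃ v≢v _) = v≢v refl

  notFree-Equiv : ∀ {v e p q} → v ≢ p → v ≢ q → NotFreeIn v (Equiv e p q)
  notFree-Equiv v≢p v≢q (fr-∀ e≢v f) =
    notFree-⇔ (notFree-app (≢-sym e≢v) v≢p) (notFree-app (≢-sym e≢v) v≢q) f

  notFree-HatIn : ∀ {v X Z p q} → v ≢ p → v ≢ q → NotFreeIn v (HatIn X Z p q)
  notFree-HatIn v≢p v≢q (fr-∃ X≢v (fr-∧₁ f)) = notFree-Equiv (≢-sym X≢v) v≢q f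
  notFree-HatIn v≢p v≢q (fr-∃ X≢v (fr-∧₂ f)) = notFree-app (≢-sym X≢v) v≢p f

  notOccurs-app : ∀ {v p q} → v ≢ p → v ≢ q → ¬ Occurs v (app p q)
  notOccurs-app v≢p v≢q oc-app₁ = v≢p refl
  notOccurs-app v≢p v≢q oc-app₂ = v≢q refl

  notOccurs-⇒ : ∀ {v φ ψ} → ¬ Occurs v φ → ¬ Occurs v ψ → ¬ Occurs v (φ ⇒ ψ)
  notOccurs-⇒ v∉φ v∉ψ (oc-⇒₁ o) = v∉φ o
  notOccurs-⇒ v∉φ v∉ψ (oc-⇒₂ o) = v∉ψ o

  notOccurs-∧ : ∀ {v φ ψ} → ¬ Occurs v φ → ¬ Occurs v ψ → ¬ Occurs v (φ ∧ᶠ ψ)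
  notOccurs-∧ v∉φ v∉ψ (oc-∧₁ o) = v∉φ o
  notOccurs-∧ v∉φ v∉ψ (oc-∧₂ o) = v∉ψ o

  notOccurs-⇔ : ∀ {v φ ψ} → ¬ Occurs v φ → ¬ Occurs v ψ → ¬ Occurs v (φ ⇔ᶠ ψ)
  notOccurs-⇔ v∉φ v∉ψ = notOccurs-∧ (notOccurs-⇒ v∉φ v∉ψ) (notOccurs-⇒ v∉ψ v∉φ)

  notOccurs-∀ : ∀ {v y φ} → v ≢ y → ¬ Occurs v φ → ¬ Occurs v (∀ᶠ y φ)
  notOccurs-∀ v≢y v∉φ oc-∀b    = v≢y refl
  notOccurs-∀ v≢y v∉φ (oc-∀ o) = v∉φ o

  notOccurs-∃ : ∀ {v y φ} → v ≢ y → ¬ Occurs v φ → ¬ Occurs v (∃ᶠ y φ)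
  notOccurs-∃ v≢y v∉φ oc-∃b    = v≢y refl
  notOccurs-∃ v≢y v∉φ (oc-∃ o) = v∉φ o

  notOccurs-HatIn : ∀ {v X Z p q} → v ≢ X → v ≢ Z → v ≢ p → v ≢ q → ¬ Occurs v (HatIn X Z p q)
  notOccurs-HatIn v≢X v≢Z v≢p v≢q =
    notOccurs-∃ v≢X (notOccurs-∧
      (notOccurs-∀ v≢Z (notOccurs-⇔ (notOccurs-app v≢Z v≢X) (notOccurs-app v≢Z v≢q)))
      (notOccurs-app v≢X v≢p))

  ⇔E₁ : ∀ {Γ φ ψ} → Γ ⊢ φ ⇔ᶠ ψ → Γ ⊢ φ → Γ ⊢ ψ
  ⇔E₁ φ⇔ψ = ⇒E (∧E₁ φ⇔ψ)

  ⇔E₂ : ∀ {Γ φ ψ} → Γ ⊢ φ ⇔ᶠ ψ → Γ ⊢ ψ → Γ ⊢ φ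
  ⇔E₂ φ⇔ψ = ⇒E (∧E₂ φ⇔ψ)

  ⇔-sym : ∀ {Γ φ ψ} → Γ ⊢ φ ⇔ᶠ ψ → Γ ⊢ ψ ⇔ᶠ φ
  ⇔-sym φ⇔ψ = ∧I (∧E₂ φ⇔ψ) (∧E₁ φ⇔ψ)

  ⇔-refl : ∀ {Γ φ} → WF φ → Γ ⊢ φ ⇔ᶠ φ
  ⇔-refl wφ = ∧I (⇒I wφ (hyp (here refl))) (⇒I wφ (hyp (here refl)))

  equiv-refl : ∀ {Γ e p} → ty p < ty e → All (NotFreeIn e) Γ → Γ ⊢ Equiv e p p
  equiv-refl {e = e} p<e Γ∌e =
    ∀I {x = e} {b = e} (inj₂ refl) (wf-Equiv p<e p<e) (wf-⇔ (wf-app p<e) (wf-app p<e))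
       (sub-refl e _) notFree-∀-bound Γ∌e (⇔-refl (wf-app p<e))

  equiv-sym : ∀ {Γ e e′ p q} → ty e′ ≡ ty e → ty p < ty e → ty q < ty e →
              e′ ≢ p → e′ ≢ q → All (NotFreeIn e′) Γ →
              Γ ⊢ Equiv e p q → Γ ⊢ Equiv e q p
  equiv-sym {e = e} {e′} {p} {q} refl p<e q<e e′≢p e′≢q Γ∌e′ e-pq =
    ∀I {x = e} {b = e′} (inj₂ refl) (wf-Equiv q<e p<e) (wf-⇔ (wf-app q<e) (wf-app p<e))
       (sub-Equiv-body q≢e p≢e) (notFree-Equiv e′≢q e′≢p) Γ∌e′
       (⇔-sym (∀E {x = e} {a = e′} (inj₂ refl) (wf-⇔ (wf-app p<e) (wf-app q<e))
                 (sub-Equiv-body p≢e q≢e) e-pq))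
    where
    p≢e : p ≢ e
    p≢e = ty<⇒≢ p<e
    q≢e : q ≢ e
    q≢e = ty<⇒≢ q<e

  equiv-transport : ∀ {Γ e p q c u φ φp φq} →
    IsSucc (ty u) (ty c) → ty c ≤ ty e → ty p ≤ ty u → ty q ≤ ty u →
    WF φ → WF φp → WF φq → Sub u p φ φp → Sub u q φ φq →
    ¬ Occurs c φ → NotFreeIn c φp → NotFreeIn c φq → All (NotFreeIn c) Γ →
    Γ ⊢ Equiv e p q → Γ ⊢ φp → Γ ⊢ φq
  equiv-transport {Γ} {e} {p} {q} {c} {u} {φ} {φp} {φq}
    u⁺≡c c≤e p≤u q≤u wfφ wfφp wfφq u:=p u:=q c∉φ c∉φp c∉φq Γ∌c e-pq φp-holds =
    ⇒E (⇒E (⇒I (wf-Equiv p<e q<e) (⇒I wfφp transported)) e-pq) φp-holds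
    where
    u<c : ty u < ty c
    u<c = proj₁ u⁺≡c
    p<c : ty p < ty c
    p<c = ≤-<-trans p≤u u<c
    q<c : ty q < ty c
    q<c = ≤-<-trans q≤u u<c
    p<e : ty p < ty e
    p<e = <-≤-trans p<c c≤e
    q<e : ty q < ty e
    q<e = <-≤-trans q<c c≤e
    Δ : List Fm
    Δ = φp ∷ Equiv e p q ∷ Γ
    C : Fm
    C = ∀ᶠ u (app c u ⇔ᶠ φ)

    c-at : ∀ {r φr} → ty r ≤ ty u → WF φr → Sub u r φ φr → (C ∷ Δ) ⊢ app c r ⇔ᶠ φr
    c-at r≤u wfφr u:=r =
      ∀E r≤u (wf-⇔ (wf-app (≤-<-trans r≤u u<c)) wfφr)
         (sub-⇔ (s-app (sv-miss (ty>⇒≢ u<c)) sv-hit) u:=r) (hyp (here refl))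

    cp⇔cq : (C ∷ Δ) ⊢ app c p ⇔ᶠ app c q
    cp⇔cq = ∀E {x = e} {a = c} c≤e (wf-⇔ (wf-app p<c) (wf-app q<c))
              (sub-Equiv-body (ty<⇒≢ p<e) (ty<⇒≢ q<e)) (hyp (there (there (here refl))))

    transported : Δ ⊢ φq
    transported =
      ∃E {x = c} {b = c} (inj₂ refl) (wf-∀ (wf-⇔ (wf-app u<c) wfφ)) (sub-refl c C)
         notFree-∃-bound c∉φq (c∉φp ∷ notFree-Equiv (ty>⇒≢ p<c) (ty>⇒≢ q<c) ∷ Γ∌c)
         (compr u⁺≡c wfφ c∉φ)
         (⇔E₁ (c-at q≤u wfφq u:=q) (⇔E₁ cp⇔cq (⇔E₂ (c-at p≤u wfφp u:=p) (hyp (there (here refl))))))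

  app⇒hatIn : ∀ {Γ X Z p q} → ty p < ty q → ty q < ty X → SuccMax (ty X) (ty q) (ty Z) →
              All (NotFreeIn Z) Γ → Γ ⊢ app q p → Γ ⊢ HatIn X Z p q
  app⇒hatIn {X = X} {Z} {p} {q} p<q q<X XqZ Γ∌Z qp =
    ∃I {x = X} {a = q} (inj₁ q<X) (wf-HatIn p<X X<Z q<Z) (wf-∧ (wf-Equiv q<Z q<Z) (wf-app p<q))
       (s-∧ (sub-Equiv (ty>⇒≢ X<Z) (ty>⇒≢ q<Z) sv-hit (sv-miss (ty<⇒≢ q<X)))
            (s-app sv-hit (sv-miss (ty<⇒≢ p<X))))
       (∧I (equiv-refl q<Z Γ∌Z) qp)
    where
    p<X : ty p < ty X
    p<X = <-trans p<q q<X
    X<Z : ty X < ty Z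
    X<Z = succMax-<ˡ XqZ
    q<Z : ty q < ty Z
    q<Z = succMax-<ʳ XqZ

  hatIn⇒app : ∀ {Γ X Z p q} → ty p < ty q → ty q < ty X → SuccMax (ty X) (ty q) (ty Z) →
              All (NotFreeIn X) Γ → All (NotFreeIn Z) Γ → Γ ⊢ HatIn X Z p q → Γ ⊢ app q p
  hatIn⇒app {Γ} {X} {Z} {p} {q} p<q q<X (m , (X≤m , q≤m , _) , m⁺≡Z) Γ∌X Γ∌Z p∈̂q =
    ∃E {x = X} {b = X} (inj₂ refl) (wf-∧ (wf-Equiv X<Z q<Z) (wf-app p<X)) (sub-refl X _)
       notFree-∃-bound (notFree-app X≢q X≢p) Γ∌X p∈̂q
       (∃E {x = Z} {b = Z} (inj₂ refl) (wf-∀ (wf-⇔ (wf-app m<Z) (wf-app p<m))) (sub-refl Z _)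
           notFree-∃-bound (notFree-app Z≢q Z≢p)
           (notFree-∧ notFree-∀-bound (notFree-app (ty>⇒≢ X<Z) Z≢p) ∷ Γ∌Z)
           (compr m⁺≡Z (wf-app p<m) (notOccurs-app Z≢v Z≢p))
           qp)
    where
    v : Var
    v = var m 0
    m<Z : m < ty Z
    m<Z = proj₁ m⁺≡Z
    p<X : ty p < ty X
    p<X = <-trans p<q q<X
    p<m : ty p < m
    p<m = <-≤-trans p<q q≤m
    X<Z : ty X < ty Z
    X<Z = ≤-<-trans X≤m m<Z
    q<Z : ty q < ty Z
    q<Z = ≤-<-trans q≤m m<Z
    X≢p : X ≢ p
    X≢p = ty>⇒≢ p<X
    X≢q : X ≢ q
    X≢q = ty>⇒≢ q<X
    Z≢p : Z ≢ p
    Z≢p = ty>⇒≢ (<-trans p<X X<Z)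
    Z≢q : Z ≢ q
    Z≢q = ty>⇒≢ q<Z
    Z≢v : Z ≢ v
    Z≢v = ty>⇒≢ m<Z
    Δ : List Fm
    Δ = ∀ᶠ v (app Z v ⇔ᶠ app v p) ∷ (Equiv Z X q ∧ᶠ app X p) ∷ Γ

    Z-at : ∀ {r} → ty p < ty r → ty r ≤ m → Δ ⊢ app Z r ⇔ᶠ app r p
    Z-at p<r r≤m = ∀E r≤m (wf-⇔ (wf-app (≤-<-trans r≤m m<Z)) (wf-app p<r))
                  (sub-⇔ (s-app (sv-miss Z≢v) sv-hit) (s-app sv-hit (sv-miss (ty<⇒≢ p<m))))
                  (hyp (here refl))

    qp : Δ ⊢ app q p
    qp = ⇔E₁ (Z-at p<q q≤m)
           (⇔E₁ (∀E {x = Z} {a = Z} (inj₂ refl) (wf-⇔ (wf-app X<Z) (wf-app q<Z)) (sub-refl Z _)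
                    (∧E₁ (hyp (there (here refl)))))
                (⇔E₂ (Z-at p<X X≤m) (∧E₂ (hyp (there (here refl))))))

  typeFounded-at : ∀ {Γ a b x z y w} → IsSucc (ty y) (ty b) → y ≢ a →
    SuccMax (ty a) (ty b) (ty x) → SuccMax (ty x) (ty b) (ty z) → SuccMax (ty a) (ty y) (ty w) →
    Γ ⊢ HatIn x z a b ⇒ ∃ᶠ y (Equiv w a y)
  typeFounded-at {a = a} {b} {x} {z} {y} {w} y⁺≡b y≢a abx xbz ayw =
    ∀E {x = b′} {a = b} (inj₂ refl) (wf-⇒ (wf-HatIn a<x x<z b<z) wf-∃equiv)
       (s-⇒ (sub-HatIn (ty>⇒≢ b<x) (ty>⇒≢ b<x) (ty>⇒≢ b<z) (ty>⇒≢ b<z)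
                       (sv-miss (≢-sym b′≢a)) sv-hit)
            (s-∃nf (ty<⇒≢ y<b′) (notFree-Equiv b′≢a (ty>⇒≢ y<b′))))
       (∀E {x = a′} {a = a} (inj₂ refl) (wf-∀ (wf-⇒ (wf-HatIn a<x x<z b<z) wf-∃equiv))
           (s-∀ b′≢a′ b′≢a
             (s-⇒ (sub-HatIn (ty>⇒≢ a<x) (ty>⇒≢ a<x) (ty>⇒≢ a<z) (ty>⇒≢ a<z)
                             sv-hit (sv-miss b′≢a′))
                  (s-∃ (≢-sym a′≢y) y≢a
                       (sub-Equiv (ty>⇒≢ a<w) (ty>⇒≢ a<w) sv-hit (sv-miss (≢-sym a′≢y))))))
           (typeFounded a′ b′ x z y w y⁺≡b (≢-sym b′≢a′) abx xbz refl (≢-sym a′≢y) ayw))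
    where
    -- Type-Founded is stated for distinct variables; instantiate it at fresh a′ ≢ b′.
    a′ : Var
    a′ = fresh (y ∷ []) (ty a)
    b′ : Var
    b′ = fresh (a′ ∷ a ∷ []) (ty b)
    a′≢y : a′ ≢ y
    a′≢y = fresh-≢ (y ∷ []) (here refl)
    b′≢a′ : b′ ≢ a′
    b′≢a′ = fresh-≢ (a′ ∷ a ∷ []) (here refl)
    b′≢a : b′ ≢ a
    b′≢a = fresh-≢ (a′ ∷ a ∷ []) (there (here refl))
    y<b′ : ty y < ty b′
    y<b′ = proj₁ y⁺≡b
    a<x : ty a < ty x
    a<x = succMax-<ˡ abx
    b<x : ty b < ty x
    b<x = succMax-<ʳ abx
    x<z : ty x < ty z
    x<z = succMax-<ˡ xbz
    b<z : ty b < ty z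
    b<z = succMax-<ʳ xbz
    a<z : ty a < ty z
    a<z = <-trans a<x x<z
    a<w : ty a < ty w
    a<w = succMax-<ˡ ayw
    wf-∃equiv : WF (∃ᶠ y (Equiv w a y))
    wf-∃equiv = wf-∃ (wf-Equiv a<w (succMax-<ʳ ayw))

  module _ {a b x z y w : Var} (y⁺≡b : IsSucc (ty y) (ty b)) (y≢a : y ≢ a)
           (abx : SuccMax (ty a) (ty b) (ty x)) (xbz : SuccMax (ty x) (ty b) (ty z))
           (yaw : SuccMax (ty y) (ty a) (ty w)) where

    private
      m : Carrier
      m = proj₁ yaw

      m⁺≡w : IsSucc m (ty w)
      m⁺≡w = proj₂ (proj₂ yaw)

      y<b : ty y < ty b
      y<b = proj₁ y⁺≡b
      a<x : ty a < ty x
      a<x = succMax-<ˡ abx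
      b<x : ty b < ty x
      b<x = succMax-<ʳ abx
      x<z : ty x < ty z
      x<z = succMax-<ˡ xbz
      b<z : ty b < ty z
      b<z = succMax-<ʳ xbz
      y<w : ty y < ty w
      y<w = succMax-<ˡ yaw
      a<w : ty a < ty w
      a<w = succMax-<ʳ yaw
      y≤m : ty y ≤ m
      y≤m = proj₁ (proj₁ (proj₂ yaw))
      a≤m : ty a ≤ m
      a≤m = proj₁ (proj₂ (proj₁ (proj₂ yaw)))
      m<w : m < ty w
      m<w = proj₁ m⁺≡w
      m<x : m < ty x
      m<x = isMax-lub (proj₁ (proj₂ yaw)) (<-trans y<b b<x) a<x
      w<z : ty w < ty z
      w<z = ≤-<-trans (proj₂ m⁺≡w (ty x) m<x) x<z

      u : Var
      u = fresh (b ∷ []) m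
      c : Var
      c = fresh (x ∷ b ∷ []) (ty w)
      c≢x : c ≢ x
      c≢x = fresh-≢ (x ∷ b ∷ []) (here refl)
      c≢b : c ≢ b
      c≢b = fresh-≢ (x ∷ b ∷ []) (there (here refl))
      c≢a : c ≢ a
      c≢a = ty>⇒≢ a<w
      c≢y : c ≢ y
      c≢y = ty>⇒≢ y<w

      z∉equiv-app : NotFreeIn z (Equiv w y a ∧ᶠ app b y)
      z∉equiv-app = notFree-∧ (notFree-Equiv (ty>⇒≢ (<-trans (<-trans y<b b<x) x<z))
                                              (ty>⇒≢ (<-trans a<x x<z)))
                              (notFree-app (ty>⇒≢ b<z) (ty>⇒≢ (<-trans y<b b<z)))

      c∉equiv-app : NotFreeIn c (Equiv w y a ∧ᶠ app b y)
      c∉equiv-app = notFree-∧ (notFree-Equiv c≢y c≢a) (notFree-app c≢b c≢y)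

      wf-equiv-app : WF (Equiv w y a ∧ᶠ app b y)
      wf-equiv-app = wf-∧ (wf-Equiv y<w a<w) (wf-app y<b)

      hatIn-transport : ∀ {Γ p q} → ty p ≤ m → ty q ≤ m → All (NotFreeIn c) Γ →
                        Γ ⊢ Equiv w p q → Γ ⊢ HatIn x z p b → Γ ⊢ HatIn x z q b
      hatIn-transport {p = p} {q} p≤m q≤m =
        equiv-transport {u = u} m⁺≡w (inj₂ refl) p≤m q≤m
          (wf-HatIn m<x x<z b<z) (wf-HatIn p<x x<z b<z) (wf-HatIn q<x x<z b<z)
          (sub-u p<x) (sub-u q<x)
          (notOccurs-HatIn c≢x (ty<⇒≢ w<z) (ty>⇒≢ m<w) c≢b)
          (notFree-HatIn (ty>⇒≢ (≤-<-trans p≤m m<w)) c≢b)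
          (notFree-HatIn (ty>⇒≢ (≤-<-trans q≤m m<w)) c≢b)
        where
        p<x : ty p < ty x
        p<x = ≤-<-trans p≤m m<x
        q<x : ty q < ty x
        q<x = ≤-<-trans q≤m m<x
        sub-u : ∀ {r} → ty r < ty x → Sub u r (HatIn x z u b) (HatIn x z r b)
        sub-u r<x = sub-HatIn (ty>⇒≢ m<x) (ty>⇒≢ r<x) (ty>⇒≢ (<-trans m<x x<z))
                              (ty>⇒≢ (<-trans r<x x<z)) sv-hit
                              (sv-miss (≢-sym (fresh-≢ (b ∷ []) (here refl))))

    hatIn⇒∃equiv-app : [] ⊢ HatIn x z a b ⇒ ∃ᶠ y (Equiv w y a ∧ᶠ app b y)
    hatIn⇒∃equiv-app =
      ⇒I (wf-HatIn a<x x<z b<z)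
         (∃E {x = y} {b = y} (inj₂ refl) (wf-Equiv a<w y<w) (sub-refl y _)
             notFree-∃-bound notFree-∃-bound (notFree-HatIn y≢a (ty<⇒≢ y<b) ∷ [])
             (⇒E (typeFounded-at y⁺≡b y≢a abx xbz (succMax-sym yaw)) (hyp (here refl)))
             (∃I {x = y} {a = y} (inj₂ refl) (wf-∃ wf-equiv-app) wf-equiv-app (sub-refl y _)
                 (∧I (equiv-sym refl a<w y<w c≢a c≢y Γ∌c a≡y)
                     (hatIn⇒app y<b b<x xbz Γ∌x Γ∌z (hatIn-transport a≤m y≤m Γ∌c a≡y a∈̂b)))))
      where
      Γ : List Fm
      Γ = Equiv w a y ∷ HatIn x z a b ∷ []
      a≡y : Γ ⊢ Equiv w a y
      a≡y = hyp (here refl)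
      a∈̂b : Γ ⊢ HatIn x z a b
      a∈̂b = hyp (there (here refl))
      Γ∌c : All (NotFreeIn c) Γ
      Γ∌c = notFree-Equiv c≢a c≢y ∷ notFree-HatIn c≢a c≢b ∷ []
      Γ∌x : All (NotFreeIn x) Γ
      Γ∌x = notFree-Equiv (ty>⇒≢ a<x) (ty>⇒≢ (<-trans y<b b<x)) ∷ notFree-∃-bound ∷ []
      Γ∌z : All (NotFreeIn z) Γ
      Γ∌z = notFree-Equiv (ty>⇒≢ (<-trans a<x x<z)) (ty>⇒≢ (<-trans (<-trans y<b b<x) x<z))
            ∷ notFree-HatIn (ty>⇒≢ (<-trans a<x x<z)) (ty>⇒≢ b<z) ∷ []

    ∃equiv-app⇒hatIn : [] ⊢ ∃ᶠ y (Equiv w y a ∧ᶠ app b y) ⇒ HatIn x z a b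
    ∃equiv-app⇒hatIn =
      ⇒I (wf-∃ wf-equiv-app)
         (∃E {x = y} {b = y} (inj₂ refl) wf-equiv-app (sub-refl y _) notFree-∃-bound
             (notFree-HatIn y≢a (ty<⇒≢ y<b)) (notFree-∃-bound ∷ []) (hyp (here refl))
             (hatIn-transport y≤m a≤m (c∉equiv-app ∷ notFree-∃ c∉equiv-app ∷ [])
                (∧E₁ (hyp (here refl)))
                (app⇒hatIn y<b b<x xbz (z∉equiv-app ∷ notFree-∃ z∉equiv-app ∷ [])
                   (∧E₂ (hyp (here refl))))))

lemmaA3 : (τ : Ordinal) → let open CTT τ in
    (α β m s₁ s₂ β⁺ : Carrier) →
    IsMax α β m → IsSucc m s₁ → IsSucc s₁ s₂ → IsSucc β β⁺ →
    (a b x z y w : Var) → ty a ≡ α → ty b ≡ β⁺ →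
    SuccMax (ty a) (ty b) (ty x) → SuccMax (ty x) (ty b) (ty z) →
    ty y ≡ β → y ≢ a → SuccMax (ty y) (ty a) (ty w) →
    [] ⊢ (HatIn x z a b ⇔ᶠ ∃ᶠ y (Equiv w y a ∧ᶠ app b y))
-- The bound max(α, β) + 2 < τ only ensures that x and z can exist; their types are
-- already pinned down by the SuccMax hypotheses.
lemmaA3 τ _ _ _ _ _ _ _ _ _ y⁺≡b _ _ _ _ _ _ refl refl abx xbz refl y≢a yaw =
  ∧I (hatIn⇒∃equiv-app y⁺≡b y≢a abx xbz yaw) (∃equiv-app⇒hatIn y⁺≡b y≢a abx xbz yaw)
  where open CTT τ using (∧I)
        open Derivations τ
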